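{- Let $n_1,\ldots,n_k,n',n''$ be positive integers. If the box $B(n_1,\ldots,n_k)$ is good and an $(n_k; n', n'')$-expansion exists, then the box $B(n_1,\ldots,n_{k-1},n',n'')$ is good.
   Context: For positive integers $m$, $[m]=\{1,\ldots,m\}$. For positive integers $n_1,\ldots,n_k$, the box is $B(n_1,\ldots,n_k) = [2n_1]\times\cdots\times[2n_k]$, and $\partial B(n_1,\ldots,n_k)$ is the set of $x \in B(n_1,\ldots,n_k)$ with $x_i \in \{1, 2n_i\}$ for some $i \in [k]$. For $x,y$ in a box, write $x \sim y$ if $x=y$ or $|x_i-y_i|=1$ for some coordinate $i$. A box $B(n_1,\ldots,n_k)$ is good if there is a subset $S \subseteq \partial B(n_1,\ldots,n_k)$ with $|S| = 2^k$ and $x\sim y$ for all $x,y\in S$. For positive integers $a,b,c$, an $(a;b,c)$-expansion is an injective function $\psi\colon B(a)\times[2] \to B(b,c)$ mapping $\partial B(a)\times[2]$ into $\partial B(b,c)$ such that for all $x,y\in B(a)$ with $x\sim y$ and all $i,j\in[2]$, $\psi(x,i)\sim\psi(y,j)$. -}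

module Defs where

open import Data.Nat using (ℕ; _+_; _*_; _^_; _≤_; ∣_-_∣)
open import Data.Fin using (Fin)
open import Data.Vec using (Vec; lookup; []; _∷_)
open import Data.List using (List; length)
open import Data.List.Relation.Unary.All using (All)
open import Data.List.Relation.Unary.Unique.Propositional using (Unique)
open import Data.List.Membership.Propositional using (_∈_)
open import Data.Product using (Σ; ∃; _×_)
open import Data.Sum using (_⊎_)
open import Relation.Binary.PropositionalEquality using (_≡_)

InBox : ∀ {k} → Vec ℕ k → Vec ℕ k → Set
InBox {k} ns x = ∀ (i : Fin k) → 1 ≤ lookup x i × lookup x i ≤ 2 * lookup ns i

InBoundary : ∀ {k} → Vec ℕ k → Vec ℕ k → Set
InBoundary {k} ns x =
  InBox ns x × ∃ λ (i : Fin k) → lookup x i ≡ 1 ⊎ lookup x i ≡ 2 * lookup ns i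

_∼_ : ∀ {k} → Vec ℕ k → Vec ℕ k → Set
_∼_ {k} x y = x ≡ y ⊎ ∃ λ (i : Fin k) → ∣ lookup x i - lookup y i ∣ ≡ 1

Good : ∀ {k} → Vec ℕ k → Set
Good {k} ns = Σ (List (Vec ℕ k)) λ S →
  Unique S × length S ≡ 2 ^ k × All (InBoundary ns) S ×
  (∀ {x y} → x ∈ S → y ∈ S → x ∼ y)

In2 : ℕ → Set
In2 i = 1 ≤ i × i ≤ 2

-- An (a;b,c)-expansion: an injective ψ : B(a) × [2] → B(b,c) mapping ∂B(a)×[2]
-- into ∂B(b,c), with ψ(x,i) ∼ ψ(y,j) whenever x ∼ y (x,y ∈ B(a), i,j ∈ [2]).
-- ψ is given as a function on all of Vec ℕ 1 × ℕ; only its values on B(a)×[2] matter.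
IsExpansion : ℕ → ℕ → ℕ → (Vec ℕ 1 → ℕ → Vec ℕ 2) → Set
IsExpansion a b c ψ =
  (∀ x i → InBox (a ∷ []) x → In2 i → InBox (b ∷ c ∷ []) (ψ x i)) ×
  (∀ x i y j → InBox (a ∷ []) x → In2 i → InBox (a ∷ []) y → In2 j →
     ψ x i ≡ ψ y j → x ≡ y × i ≡ j) ×
  (∀ x i → InBoundary (a ∷ []) x → In2 i → InBoundary (b ∷ c ∷ []) (ψ x i)) ×
  (∀ x i y j → InBox (a ∷ []) x → In2 i → InBox (a ∷ []) y → In2 j →
     x ∼ y → ψ x i ∼ ψ y j)

Expansion : ℕ → ℕ → ℕ → Set
Expansion a b c = Σ (Vec ℕ 1 → ℕ → Vec ℕ 2) (IsExpansion a b c)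

-- Let S be a good set in B(n₁,…,n_k) and ψ an (n_k; n′, n″)-expansion.  Splitting
-- each x ∈ S as (y, t) with t its last coordinate, the points (y, ψ(t,1)) and
-- (y, ψ(t,2)) form a set of twice the size in B(n₁,…,n_{k-1},n′,n″).  It lies on the
-- boundary since ∂(B × B′) = ∂B × B′ ∪ B × ∂B′, and it is pairwise ∼ because ψ
-- preserves ∼; when x and x′ differ by 1 in the last coordinate, injectivity of ψ
-- forces ψ(t,i) ≠ ψ(t′,j), so the images differ by 1 in some coordinate.
module Submission where

open import Defs
open import Data.Nat using (ℕ; suc; _≤_; _*_; _+_; ∣_-_∣; z≤n; s≤s)
open import Data.Vec using (Vec; _∷ʳ_; _++_; _∷_; [])
open import Data.Vec.Relation.Unary.All using (All)

open import Data.Nat.Properties using (+-comm; *-suc; ∣n-n∣≡0; 0≢1+n)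
open import Data.Fin using (Fin; zero; suc)
open import Data.Vec using (lookup; init; last; initLast)
open import Data.Vec.Properties using (++-injective; ∷-injectiveˡ)
open import Data.List using (List; []; _∷_; length)
import Data.List.Relation.Unary.All as ListAll
open ListAll using ([]; _∷_)
open import Data.List.Relation.Unary.Any using (here; there)
open import Data.List.Relation.Unary.AllPairs using ([]; _∷_)
open import Data.List.Relation.Unary.Unique.Propositional using (Unique)
open import Data.List.Membership.Propositional using (_∈_)
open import Data.Product using (∃; ∃₂; _×_; _,_; proj₁; proj₂)
import Data.Product as Product
open import Data.Sum using (_⊎_; inj₁; inj₂)
import Data.Sum as Sum
open import Function using (_∘_)
open import Relation.Nullary using (contradiction)
open import Relation.Binary.PropositionalEquality

module _ {A B : Set} (R : A → B → Set) where

  AllCoords : ∀ {k} → Vec A k → Vec B k → Set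
  AllCoords {k} xs ys = ∀ (i : Fin k) → R (lookup xs i) (lookup ys i)

  AnyCoord : ∀ {k} → Vec A k → Vec B k → Set
  AnyCoord {k} xs ys = ∃ λ (i : Fin k) → R (lookup xs i) (lookup ys i)

  allCoords-∷ʳ⁻ : ∀ {k} (xs : Vec A k) (ys : Vec B k) {x y} →
    AllCoords (xs ∷ʳ x) (ys ∷ʳ y) → AllCoords xs ys × R x y
  allCoords-∷ʳ⁻ []       []       r = (λ ()) , r zero
  allCoords-∷ʳ⁻ (_ ∷ xs) (_ ∷ ys) r =
    let rs , rxy = allCoords-∷ʳ⁻ xs ys (r ∘ suc)
    in (λ { zero → r zero ; (suc i) → rs i }) , rxy

  allCoords-++⁺ : ∀ {k m} (xs : Vec A k) (ys : Vec B k) {xs′ : Vec A m} {ys′ : Vec B m} →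
    AllCoords xs ys → AllCoords xs′ ys′ → AllCoords (xs ++ xs′) (ys ++ ys′)
  allCoords-++⁺ []       []       _ r′         = r′
  allCoords-++⁺ (_ ∷ xs) (_ ∷ ys) r r′ zero    = r zero
  allCoords-++⁺ (_ ∷ xs) (_ ∷ ys) r r′ (suc i) = allCoords-++⁺ xs ys (r ∘ suc) r′ i

  anyCoord-∷ʳ⁻ : ∀ {k} (xs : Vec A k) (ys : Vec B k) {x y} →
    AnyCoord (xs ∷ʳ x) (ys ∷ʳ y) → AnyCoord xs ys ⊎ R x y
  anyCoord-∷ʳ⁻ []       []       (zero , r)  = inj₂ r
  anyCoord-∷ʳ⁻ (_ ∷ xs) (_ ∷ ys) (zero , r)  = inj₁ (zero , r)
  anyCoord-∷ʳ⁻ (_ ∷ xs) (_ ∷ ys) (suc i , r) =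
    Sum.map₁ (λ (j , r′) → suc j , r′) (anyCoord-∷ʳ⁻ xs ys (i , r))

  anyCoord-++⁺ˡ : ∀ {k m} (xs : Vec A k) (ys : Vec B k) {xs′ : Vec A m} {ys′ : Vec B m} →
    AnyCoord xs ys → AnyCoord (xs ++ xs′) (ys ++ ys′)
  anyCoord-++⁺ˡ (_ ∷ xs) (_ ∷ ys) (zero , r)  = zero , r
  anyCoord-++⁺ˡ (_ ∷ xs) (_ ∷ ys) (suc i , r) =
    let j , r′ = anyCoord-++⁺ˡ xs ys (i , r) in suc j , r′

  anyCoord-++⁺ʳ : ∀ {k m} (xs : Vec A k) (ys : Vec B k) {xs′ : Vec A m} {ys′ : Vec B m} →
    AnyCoord xs′ ys′ → AnyCoord (xs ++ xs′) (ys ++ ys′)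
  anyCoord-++⁺ʳ []       []       r = r
  anyCoord-++⁺ʳ (_ ∷ xs) (_ ∷ ys) r = let j , r′ = anyCoord-++⁺ʳ xs ys r in suc j , r′

InRange AtEnd Adjacent : ℕ → ℕ → Set
InRange  u n = 1 ≤ u × u ≤ 2 * n
AtEnd    u n = u ≡ 1 ⊎ u ≡ 2 * n
Adjacent u v = ∣ u - v ∣ ≡ 1

-- InBox ns x, InBoundary ns x and x ∼ y are definitionally AllCoords InRange x ns,
-- InBox ns x × AnyCoord AtEnd x ns and x ≡ y ⊎ AnyCoord Adjacent x y.

inBox-∷ʳ⁻ : ∀ {k} (ns ys : Vec ℕ k) {n y} →
  InBox (ns ∷ʳ n) (ys ∷ʳ y) → InBox ns ys × InBox (n ∷ []) (y ∷ [])
inBox-∷ʳ⁻ ns ys b = Product.map₂ (λ r → λ { zero → r }) (allCoords-∷ʳ⁻ InRange ys ns b)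

inBox-++⁺ : ∀ {k m} (ns ys : Vec ℕ k) {ms zs : Vec ℕ m} →
  InBox ns ys → InBox ms zs → InBox (ns ++ ms) (ys ++ zs)
inBox-++⁺ ns ys = allCoords-++⁺ InRange ys ns

inBoundary-∷ʳ⁻ : ∀ {k} (ns ys : Vec ℕ k) {n y} → InBoundary (ns ∷ʳ n) (ys ∷ʳ y) →
  InBoundary ns ys × InBox (n ∷ []) (y ∷ []) ⊎ InBox ns ys × InBoundary (n ∷ []) (y ∷ [])
inBoundary-∷ʳ⁻ ns ys (b , e) =
  let bys , by = inBox-∷ʳ⁻ ns ys b
  in Sum.map (λ e′ → (bys , e′) , by) (λ e′ → bys , by , zero , e′) (anyCoord-∷ʳ⁻ AtEnd ys ns e)

inBoundary-++⁺ : ∀ {k m} (ns ys : Vec ℕ k) {ms zs : Vec ℕ m} →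
  InBoundary ns ys × InBox ms zs ⊎ InBox ns ys × InBoundary ms zs →
  InBoundary (ns ++ ms) (ys ++ zs)
inBoundary-++⁺ ns ys (inj₁ ((b , e) , b′)) = inBox-++⁺ ns ys b b′ , anyCoord-++⁺ˡ AtEnd ys ns e
inBoundary-++⁺ ns ys (inj₂ (b , b′ , e))   = inBox-++⁺ ns ys b b′ , anyCoord-++⁺ʳ AtEnd ys ns e

adjacent-irrefl : ∀ {u v} → Adjacent u v → u ≢ v
adjacent-irrefl {u} d refl = 0≢1+n (trans (sym (∣n-n∣≡0 u)) d)

anyAdjacent-irrefl : ∀ {k} {x y : Vec ℕ k} → AnyCoord Adjacent x y → x ≢ y
anyAdjacent-irrefl {x = x} (i , d) refl = adjacent-irrefl {lookup x i} d refl

∼-++⁺ʳ : ∀ {k m} (ys : Vec ℕ k) {zs zs′ : Vec ℕ m} → zs ∼ zs′ → (ys ++ zs) ∼ (ys ++ zs′)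
∼-++⁺ʳ ys (inj₁ refl) = inj₁ refl
∼-++⁺ʳ ys (inj₂ a)    = inj₂ (anyCoord-++⁺ʳ Adjacent ys ys a)

one∈[2] : In2 1
one∈[2] = s≤s z≤n , s≤s z≤n

two∈[2] : In2 2
two∈[2] = s≤s z≤n , s≤s (s≤s z≤n)

record IsBoxExpansion {k m} (ns : Vec ℕ k) (ms : Vec ℕ m) (φ : Vec ℕ k → ℕ → Vec ℕ m) : Set where
  field
    maps-box      : ∀ x i → InBox ns x → In2 i → InBox ms (φ x i)
    injective     : ∀ x i y j → InBox ns x → In2 i → InBox ns y → In2 j →
                    φ x i ≡ φ y j → x ≡ y × i ≡ j
    maps-boundary : ∀ x i → InBoundary ns x → In2 i → InBoundary ms (φ x i)
    preserves-∼   : ∀ x i y j → InBox ns x → In2 i → InBox ns y → In2 j →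
                    x ∼ y → φ x i ∼ φ y j

  preserves-adjacency : ∀ x i y j → InBox ns x → In2 i → InBox ns y → In2 j →
    AnyCoord Adjacent x y → AnyCoord Adjacent (φ x i) (φ y j)
  preserves-adjacency x i y j bx i2 by j2 a with preserves-∼ x i y j bx i2 by j2 (inj₂ a)
  ... | inj₂ a′ = a′
  ... | inj₁ eq = contradiction (proj₁ (injective x i y j bx i2 by j2 eq)) (anyAdjacent-irrefl a)

isExpansion⇒isBoxExpansion : ∀ {a b c ψ} →
  IsExpansion a b c ψ → IsBoxExpansion (a ∷ []) (b ∷ c ∷ []) ψ
isExpansion⇒isBoxExpansion (box , inj , boundary , sim) = record
  { maps-box = box ; injective = inj ; maps-boundary = boundary ; preserves-∼ = sim }

module _ {k m n} (ns : Vec ℕ k) {ms : Vec ℕ m} {ψ : Vec ℕ 1 → ℕ → Vec ℕ m}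
  (E : IsBoxExpansion (n ∷ []) ms ψ) where
  open IsBoxExpansion E

  extendLast : Vec ℕ (suc k) → ℕ → Vec ℕ (k + m)
  extendLast x i = init x ++ ψ (last x ∷ []) i

  private
    init-∷ʳ-last : ∀ (x : Vec ℕ (suc k)) → x ≡ init x ∷ʳ last x
    init-∷ʳ-last x = proj₂ (proj₂ (initLast x))

    inBox-init-last : ∀ x → InBox (ns ∷ʳ n) x → InBox ns (init x) × InBox (n ∷ []) (last x ∷ [])
    inBox-init-last x bx = inBox-∷ʳ⁻ ns (init x) (subst (InBox (ns ∷ʳ n)) (init-∷ʳ-last x) bx)

    inBox-last : ∀ x → InBox (ns ∷ʳ n) x → InBox (n ∷ []) (last x ∷ [])
    inBox-last x = proj₂ ∘ inBox-init-last x

  extendLast-maps-box : ∀ x i → InBox (ns ∷ʳ n) x → In2 i → InBox (ns ++ ms) (extendLast x i)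
  extendLast-maps-box x i bx i2 =
    let binit , blast = inBox-init-last x bx
    in inBox-++⁺ ns (init x) binit (maps-box _ i blast i2)

  extendLast-injective : ∀ x i y j → InBox (ns ∷ʳ n) x → In2 i → InBox (ns ∷ʳ n) y → In2 j →
    extendLast x i ≡ extendLast y j → x ≡ y × i ≡ j
  extendLast-injective x i y j bx i2 by j2 eq =
    let init≡ , ψ≡ = ++-injective (init x) (init y) eq
        [last]≡ , i≡j = injective _ i _ j (inBox-last x bx) i2 (inBox-last y by) j2 ψ≡
    in (begin
          x                 ≡⟨ init-∷ʳ-last x ⟩
          init x ∷ʳ last x  ≡⟨ cong₂ _∷ʳ_ init≡ (∷-injectiveˡ [last]≡) ⟩
          init y ∷ʳ last y  ≡⟨ init-∷ʳ-last y ⟨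
          y                 ∎) , i≡j
    where open ≡-Reasoning

  extendLast-maps-boundary : ∀ x i → InBoundary (ns ∷ʳ n) x → In2 i →
    InBoundary (ns ++ ms) (extendLast x i)
  extendLast-maps-boundary x i ∂x i2 =
    inBoundary-++⁺ ns (init x)
      (Sum.map (Product.map₂ (λ by → maps-box _ i by i2))
               (Product.map₂ (λ ∂y → maps-boundary _ i ∂y i2))
               (inBoundary-∷ʳ⁻ ns (init x) (subst (InBoundary (ns ∷ʳ n)) (init-∷ʳ-last x) ∂x)))

  extendLast-preserves-∼ : ∀ x i y j → InBox (ns ∷ʳ n) x → In2 i → InBox (ns ∷ʳ n) y → In2 j →
    x ∼ y → extendLast x i ∼ extendLast y j
  extendLast-preserves-∼ x i _ j bx i2 _ j2 (inj₁ refl) =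
    ∼-++⁺ʳ (init x) (preserves-∼ _ i _ j (inBox-last x bx) i2 (inBox-last x bx) j2 (inj₁ refl))
  extendLast-preserves-∼ x i y j bx i2 by j2 (inj₂ a)
    with anyCoord-∷ʳ⁻ Adjacent (init x) (init y)
           (subst₂ (AnyCoord Adjacent) (init-∷ʳ-last x) (init-∷ʳ-last y) a)
  ... | inj₁ a′ = inj₂ (anyCoord-++⁺ˡ Adjacent (init x) (init y) a′)
  ... | inj₂ d  = inj₂ (anyCoord-++⁺ʳ Adjacent (init x) (init y)
                   (preserves-adjacency _ i _ j (inBox-last x bx) i2 (inBox-last y by) j2 (zero , d)))

  isBoxExpansion-extendLast : IsBoxExpansion (ns ∷ʳ n) (ns ++ ms) extendLast
  isBoxExpansion-extendLast = record
    { maps-box      = extendLast-maps-box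
    ; injective     = extendLast-injective
    ; maps-boundary = extendLast-maps-boundary
    ; preserves-∼   = extendLast-preserves-∼
    }

doubleMap : ∀ {A B : Set} → (A → ℕ → B) → List A → List B
doubleMap f []       = []
doubleMap f (x ∷ xs) = f x 1 ∷ f x 2 ∷ doubleMap f xs

module _ {A B : Set} (f : A → ℕ → B) where

  length-doubleMap : ∀ xs → length (doubleMap f xs) ≡ 2 * length xs
  length-doubleMap []       = refl
  length-doubleMap (x ∷ xs) =
    trans (cong (2 +_) (length-doubleMap xs)) (sym (*-suc 2 (length xs)))

  ∈-doubleMap⁻ : ∀ {y} xs → y ∈ doubleMap f xs → ∃₂ λ x i → x ∈ xs × In2 i × y ≡ f x i
  ∈-doubleMap⁻ (x ∷ xs) (here refl)         = x , 1 , here refl , one∈[2] , refl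
  ∈-doubleMap⁻ (x ∷ xs) (there (here refl)) = x , 2 , here refl , two∈[2] , refl
  ∈-doubleMap⁻ (x ∷ xs) (there (there y∈))  =
    let x′ , i , x′∈ , i2 , eq = ∈-doubleMap⁻ xs y∈ in x′ , i , there x′∈ , i2 , eq

  all-doubleMap⁺ : ∀ {P : A → Set} {Q : B → Set} → (∀ {x i} → P x → In2 i → Q (f x i)) →
    ∀ {xs} → ListAll.All P xs → ListAll.All Q (doubleMap f xs)
  all-doubleMap⁺ h []         = []
  all-doubleMap⁺ h (px ∷ pxs) = h px one∈[2] ∷ h px two∈[2] ∷ all-doubleMap⁺ h pxs

  unique-doubleMap : ∀ {P : A → Set} →
    (∀ {x i y j} → P x → In2 i → P y → In2 j → f x i ≡ f y j → x ≡ y × i ≡ j) →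
    ∀ {xs} → ListAll.All P xs → Unique xs → Unique (doubleMap f xs)
  unique-doubleMap inj {[]} _ _ = []
  unique-doubleMap inj {x ∷ xs} (px ∷ pxs) (x∉xs ∷ xs!) =
    (f₁≢f₂ ∷ fresh one∈[2]) ∷ fresh two∈[2] ∷ unique-doubleMap inj pxs xs!
    where
    f₁≢f₂ : f x 1 ≢ f x 2
    f₁≢f₂ eq with proj₂ (inj px one∈[2] px two∈[2] eq)
    ... | ()

    fresh : ∀ {i} → In2 i → ListAll.All (f x i ≢_) (doubleMap f xs)
    fresh i2 = ListAll.tabulate λ y∈ eq →
      let x′ , j , x′∈ , j2 , y≡ = ∈-doubleMap⁻ xs y∈
      in ListAll.lookup x∉xs x′∈ (proj₁ (inj px i2 (ListAll.lookup pxs x′∈) j2 (trans eq y≡)))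

good-expand : ∀ {k m} {ns : Vec ℕ k} {ms : Vec ℕ m} {φ : Vec ℕ k → ℕ → Vec ℕ m} →
  suc k ≡ m → IsBoxExpansion ns ms φ → Good ns → Good ms
good-expand {φ = φ} refl E (S , S! , |S| , ∂S , S-clique) =
  doubleMap φ S ,
  unique-doubleMap φ (λ bx i2 by j2 → injective _ _ _ _ bx i2 by j2) (ListAll.map proj₁ ∂S) S! ,
  trans (length-doubleMap φ S) (cong (2 *_) |S|) ,
  all-doubleMap⁺ φ (λ ∂x i2 → maps-boundary _ _ ∂x i2) ∂S ,
  clique
  where
  open IsBoxExpansion E

  clique : ∀ {y y′} → y ∈ doubleMap φ S → y′ ∈ doubleMap φ S → y ∼ y′
  clique y∈ y′∈ with ∈-doubleMap⁻ φ S y∈ | ∈-doubleMap⁻ φ S y′∈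
  ... | x , i , x∈ , i2 , refl | x′ , j , x′∈ , j2 , refl =
    preserves-∼ x i x′ j (proj₁ (ListAll.lookup ∂S x∈)) i2 (proj₁ (ListAll.lookup ∂S x′∈)) j2
      (S-clique x∈ x′∈)

proposition2p5 : ∀ {k} (ns : Vec ℕ k) (nk n′ n″ : ℕ) →
    All (1 ≤_) ns → 1 ≤ nk → 1 ≤ n′ → 1 ≤ n″ →
    Good (ns ∷ʳ nk) → Expansion nk n′ n″ →
    Good (ns ++ (n′ ∷ n″ ∷ []))
proposition2p5 {k} ns nk n′ n″ _ _ _ _ good (ψ , E) =
  good-expand (sym (+-comm k 2))
    (isBoxExpansion-extendLast ns (isExpansion⇒isBoxExpansion E)) good
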